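{- Let $m$ and $r$ be positive integers. For each $n\ge 0$, the coefficient of $x^n/n!$ in the power series \[ \Biggl(\sum_{k=0}^{m-1} \left(\frac{x^{kr}}{(kr)!} - \frac{x^{kr+1}}{(kr+1)!} \right)\Biggr)^{ -1} \] is the number of permutations of $[n]=\{1,2,\dots,n\}$ in which every increasing run has length congruent to $0, 1, \dots,$ or $r-1$ modulo $mr$.
   Context: The increasing runs of a permutation $\pi_1\pi_2\cdots\pi_n$ (written in one-line notation) are its maximal increasing consecutive subsequences; for example, the increasing runs of $132576$ are $13$, $257$, and $6$, with lengths $2,3,1$. The empty permutation (for $n=0$) has no runs, so it satisfies the condition vacuously. -}

module Defs where

open import Data.Bool using (Bool; true; false; if_then_else_; _∧_; not)
open import Data.Nat as ℕ using (ℕ; zero; suc; _∸_; _<ᵇ_; _≡ᵇ_; NonZero; _!; _%_)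
open import Data.Nat.Properties using (_!≢0; m*n≢0)
open import Data.Integer using (+_)
open import Data.Rational as ℚ using (ℚ; _/_; 0ℚ; 1ℚ; _+_; _-_; _*_)
open import Data.List using (List; []; _∷_; map)
open import Data.Fin using (Fin; toℕ)
open import Data.Vec using (Vec; toList)
open import Data.Product using (Σ)
open import Relation.Binary.PropositionalEquality using (_≡_)

-- Formal power series with rational coefficients: ℕ → ℚ (coefficient of x^j)

sumℚ : ℕ → (ℕ → ℚ) → ℚ
sumℚ zero    f = 0ℚ
sumℚ (suc n) f = sumℚ n f + f n

monoFact : ℕ → (ℕ → ℚ)
monoFact e j = if j ≡ᵇ e then ((+ 1) / (e !)) {{e !≢0}} else 0ℚ

_⋆_ : (ℕ → ℚ) → (ℕ → ℚ) → (ℕ → ℚ)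
(a ⋆ b) n = sumℚ (suc n) (λ i → a i * b (n ∸ i))

oneSeries : ℕ → ℚ
oneSeries n = if n ≡ᵇ 0 then 1ℚ else 0ℚ

IsInverseOf : (ℕ → ℚ) → (ℕ → ℚ) → Set
IsInverseOf b a = ∀ n → (a ⋆ b) n ≡ oneSeries n

F : ℕ → ℕ → (ℕ → ℚ)
F m r j = sumℚ m (λ k → monoFact (k ℕ.* r) j - monoFact (suc (k ℕ.* r)) j)

allB : {A : Set} → (A → Bool) → List A → Bool
allB p []       = true
allB p (x ∷ xs) = p x ∧ allB p xs

distinct : List ℕ → Bool
distinct []       = true
distinct (x ∷ xs) = allB (λ y → not (x ≡ᵇ y)) xs ∧ distinct xs

runsFrom : ℕ → ℕ → List ℕ → List ℕ
runsFrom prev len []       = len ∷ []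
runsFrom prev len (y ∷ ys) =
  if prev <ᵇ y then runsFrom y (suc len) ys else len ∷ runsFrom y 1 ys

runLengths : List ℕ → List ℕ
runLengths []       = []
runLengths (x ∷ xs) = runsFrom x 1 xs

-- one-line notation π₁…πₙ (values 0..n-1 encode 1..n)
word : ∀ {n} → Vec (Fin n) n → List ℕ
word v = map toℕ (toList v)

-- a vector in Fin n of length n is a permutation iff its entries are distinct
isPerm : ∀ {n} → Vec (Fin n) n → Bool
isPerm v = distinct (word v)

runsOK : (m r : ℕ) → .{{NonZero m}} → .{{NonZero r}} → List ℕ → Bool
runsOK m r ls = allB (λ l → (l % (m ℕ.* r)) {{m*n≢0 m r}} <ᵇ r) ls

GoodPerm : (m r : ℕ) → .{{NonZero m}} → .{{NonZero r}} → ℕ → Set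
GoodPerm m r n =
  Σ (Vec (Fin n) n) (λ v → Data.Bool.T (isPerm v ∧ runsOK m r (runLengths (word v))))

module Submission where

-- A permutation of [n] is encoded by a code u₁ … uₙ with uᵢ < n − i + 1:
-- its first letter, followed by the code of the remaining word with that letter squeezed out.
-- Position i is an ascent of the permutation iff uᵢ ≤ uᵢ₊₁, so good permutations correspond to
-- good codes.  Let rising i be the set of codes whose first i letters are weakly increasing and
-- whose remaining code is good; choosing the first i values gives |rising i| = C(n, i) · G (n − i)
-- (hockey-stick identity).  A code lies in rising i iff its first run, of length j, satisfies
-- i ≤ j with j − i admissible, and its later runs are admissible.  Exactly one k < m has kr ≤ j
-- and j − kr admissible, so counting every code once on each side gives
--     Σ_{k<m} |rising (kr)| = [n = 0] + Σ_{k<m} |rising (kr + 1)|.  With egf n = G n / n!, the Cauchy product of x^e/e! and egf has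
-- n-th coefficient |rising e| / n!, so the identity says F ⋆ egf = 1.  Since F has constant term 1
-- its inverse is unique, whence every inverse b satisfies b n · n! = G n.

open import Data.Bool using (Bool; true; false; T; _∧_; not)
open import Data.Bool.Properties using (T-irrelevant; ∧-zeroʳ; T-≡; T-not-≡; T-∧; ⇔→≡)
open import Data.Fin using (Fin; toℕ; punchIn) renaming (zero to fz; suc to fs)
open import Data.Fin.Properties using (toℕ<n; +↔⊎)
open import Data.List as List using (List; []; _∷_)
open import Data.Vec as Vec using (Vec; []; _∷_; toList)
open import Data.Vec.Properties using (map-∘; map-cong; map-id)
open import Data.Product using (Σ; _,_; proj₁; proj₂)
open import Data.Product.Function.Dependent.Propositional using (Σ-↔)
open import Data.Sum using (_⊎_; inj₁; inj₂)
open import Data.Sum.Function.Propositional using (_⊎-↔_)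
open import Data.Empty using (⊥-elim)
open import Function using (_∘_)
open import Function.Bundles using (_↔_; mk↔ₛ′; Equivalence; mk⇔)
open import Function.Properties.Inverse using (↔-refl; ↔-sym; ↔-trans)
open import Relation.Binary.PropositionalEquality
open import Relation.Nullary using (yes; no)
import Data.Nat.Properties as ℕP
open import Algebra.Properties.Semiring.Sum ℕP.+-*-semiring
  using (sum-syntax; sum-cong-≗; sum-replicate-zero; ∑-distrib-+; *-distribˡ-sum; *-distribʳ-sum)
open import Defs using (allB; distinct; runsFrom; runLengths; word; isPerm; runsOK; GoodPerm)

-- Part I: counting permutations through codes (natural-number arithmetic).
module _ where
  open import Data.Nat
  open import Data.Nat.Properties
  open import Data.Nat.DivMod
  open import Data.Nat.Divisibility using (n∣m*n)
  open import Data.Nat.Combinatorics using (_C_; nCk+nC[k+1]≡[n+1]C[k+1])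
  open import Algebra.Properties.CommutativeSemigroup +-commutativeSemigroup using (xy∙z≈xz∙y)

  ⟦_⟧ : Bool → ℕ
  ⟦ true ⟧  = 1
  ⟦ false ⟧ = 0

  ⟦∧⟧ : ∀ a b → ⟦ a ∧ b ⟧ ≡ ⟦ a ⟧ * ⟦ b ⟧
  ⟦∧⟧ true  b = sym (+-identityʳ ⟦ b ⟧)
  ⟦∧⟧ false b = refl

  ∑-indicator : ∀ m q → q < m → ∑[ i < m ] ⟦ toℕ i ≡ᵇ q ⟧ ≡ 1
  ∑-indicator (suc m) zero    _   = cong suc (sum-replicate-zero m)
  ∑-indicator (suc m) (suc q) q<m = ∑-indicator m q (s≤s⁻¹ q<m)

  Σ-≡-T : ∀ {A : Set} {P : A → Bool} {a a' : A} {p : T (P a)} {p' : T (P a')} →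
    a ≡ a' → _≡_ {A = Σ A (T ∘ P)} (a , p) (a' , p')
  Σ-≡-T {p = p} {p'} refl = cong (_ ,_) (T-irrelevant p p')

  hockey-stick : ∀ K l → ∑[ t < suc K ] ((K ∸ toℕ t) C l) ≡ suc K C suc l
  hockey-stick zero    l = nCk+nC[k+1]≡[n+1]C[k+1] 0 l
  hockey-stick (suc K) l =
    trans (cong (suc K C l +_) (hockey-stick K l)) (nCk+nC[k+1]≡[n+1]C[k+1] (suc K) l)

  ≤ᵇ-suc : ∀ u t → (suc u ≤ᵇ suc t) ≡ (u ≤ᵇ t)
  ≤ᵇ-suc zero    t = refl
  ≤ᵇ-suc (suc u) t = refl

  hockey-stick-from : ∀ K U l → U ≤ suc K →
    ∑[ t < suc K ] (⟦ U ≤ᵇ toℕ t ⟧ * ((K ∸ toℕ t) C l)) ≡ (suc K ∸ U) C suc l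
  hockey-stick-from K zero l _ =
    trans (sum-cong-≗ {suc K} (λ t → *-identityˡ ((K ∸ toℕ t) C l))) (hockey-stick K l)
  hockey-stick-from zero (suc zero) l _ = refl
  hockey-stick-from zero (suc (suc U)) l (s≤s ())
  hockey-stick-from (suc K) (suc U) l U≤K =
    trans (sum-cong-≗ {suc K} (λ t → cong (λ b → ⟦ b ⟧ * ((K ∸ toℕ t) C l)) (≤ᵇ-suc U (toℕ t))))
          (hockey-stick-from K U l (s≤s⁻¹ U≤K))

  -- Codes of length n: sequences u₁ u₂ … uₙ with uᵢ < n − i + 1.  They are in bijection with
  -- the permutations of [n] (see fromCode below), and all counting is done on them.
  data Code : ℕ → Set where
    nil : Code 0
    _◂_ : ∀ {n} → Fin (suc n) → Code n → Code (suc n)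

  ∑Code : ∀ n → (Code n → ℕ) → ℕ
  ∑Code zero    w = w nil
  ∑Code (suc n) w = ∑[ u < suc n ] ∑Code n (λ c → w (u ◂ c))

  count : ∀ n → (Code n → Bool) → ℕ
  count n P = ∑Code n (λ c → ⟦ P c ⟧)

  ∑Code-cong : ∀ n {v w : Code n → ℕ} → (∀ c → v c ≡ w c) → ∑Code n v ≡ ∑Code n w
  ∑Code-cong zero    eq = eq nil
  ∑Code-cong (suc n) eq = sum-cong-≗ {suc n} (λ u → ∑Code-cong n (λ c → eq (u ◂ c)))

  ∑Code-zero : ∀ n → ∑Code n (λ _ → 0) ≡ 0
  ∑Code-zero zero    = refl
  ∑Code-zero (suc n) = trans (sum-cong-≗ {suc n} (λ _ → ∑Code-zero n)) (sum-replicate-zero (suc n))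

  ∑Code-+ : ∀ n (v w : Code n → ℕ) → ∑Code n (λ c → v c + w c) ≡ ∑Code n v + ∑Code n w
  ∑Code-+ zero    v w = refl
  ∑Code-+ (suc n) v w =
    trans (sum-cong-≗ {suc n} (λ u → ∑Code-+ n (λ c → v (u ◂ c)) (λ c → w (u ◂ c))))
          (∑-distrib-+ (λ u → ∑Code n (λ c → v (u ◂ c))) (λ u → ∑Code n (λ c → w (u ◂ c))))

  ∑Code-*ˡ : ∀ n a (w : Code n → ℕ) → ∑Code n (λ c → a * w c) ≡ a * ∑Code n w
  ∑Code-*ˡ zero    a w = refl
  ∑Code-*ˡ (suc n) a w =
    trans (sum-cong-≗ {suc n} (λ u → ∑Code-*ˡ n a (λ c → w (u ◂ c))))
          (sym (*-distribˡ-sum a (λ u → ∑Code n (λ c → w (u ◂ c)))))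

  ∑Code-∑ : ∀ n K (f : Fin K → Code n → ℕ) →
    ∑Code n (λ c → ∑[ k < K ] f k c) ≡ ∑[ k < K ] ∑Code n (f k)
  ∑Code-∑ n zero    f = ∑Code-zero n
  ∑Code-∑ n (suc K) f =
    trans (∑Code-+ n (f fz) (λ c → ∑[ k < K ] f (fs k) c)) (cong (∑Code n (f fz) +_) (∑Code-∑ n K (f ∘ fs)))

  Σ-Fin-↔ : ∀ k (f : Fin k → ℕ) → Σ (Fin k) (λ u → Fin (f u)) ↔ Fin (∑[ u < k ] f u)
  Σ-Fin-↔ zero    f = mk↔ₛ′ (λ { (() , _) }) (λ ()) (λ ()) (λ { (() , _) })
  Σ-Fin-↔ (suc k) f = ↔-trans split (↔-trans (↔-refl ⊎-↔ Σ-Fin-↔ k (f ∘ fs)) (↔-sym +↔⊎))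
    where
    split : Σ (Fin (suc k)) (λ u → Fin (f u)) ↔ (Fin (f fz) ⊎ Σ (Fin k) (λ u → Fin (f (fs u))))
    split = mk↔ₛ′ to from (λ { (inj₁ _) → refl ; (inj₂ _) → refl }) (λ { (fz , _) → refl ; (fs _ , _) → refl })
      where
      to : Σ (Fin (suc k)) (λ u → Fin (f u)) → Fin (f fz) ⊎ Σ (Fin k) (λ u → Fin (f (fs u)))
      to (fz , x)   = inj₁ x
      to (fs u , x) = inj₂ (u , x)
      from : Fin (f fz) ⊎ Σ (Fin k) (λ u → Fin (f (fs u))) → Σ (Fin (suc k)) (λ u → Fin (f u))
      from (inj₁ x)       = fz , x
      from (inj₂ (u , x)) = fs u , x

  count-↔ : ∀ n (P : Code n → Bool) → Σ (Code n) (T ∘ P) ↔ Fin (count n P)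
  count-↔ zero P with P nil in eq
  ... | true  = mk↔ₛ′ (λ _ → fz) (λ _ → nil , subst T (sym eq) _) (λ { fz → refl ; (fs ()) })
                      (λ { (nil , _) → Σ-≡-T refl })
  ... | false = mk↔ₛ′ (λ { (nil , p) → ⊥-elim (subst T eq p) }) (λ ()) (λ ())
                      (λ { (nil , p) → ⊥-elim (subst T eq p) })
  count-↔ (suc n) P =
    ↔-trans uncons (↔-trans (Σ-↔ ↔-refl (count-↔ n (P ∘ (_ ◂_)))) (Σ-Fin-↔ (suc n) (λ u → count n (P ∘ (u ◂_)))))
    where
    uncons : Σ (Code (suc n)) (T ∘ P) ↔ Σ (Fin (suc n)) (λ u → Σ (Code n) (λ c → T (P (u ◂ c))))
    uncons = mk↔ₛ′ (λ { ((u ◂ c) , p) → u , c , p }) (λ { (u , c , p) → (u ◂ c) , p })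
                   (λ _ → refl) (λ { ((_ ◂ _) , _) → refl })

  runsOf : ℕ → List Bool → List ℕ
  runsOf len []           = len ∷ []
  runsOf len (true ∷ bs)  = runsOf (suc len) bs
  runsOf len (false ∷ bs) = len ∷ runsOf 1 bs

  leadingAscents : List Bool → ℕ
  leadingAscents []           = 0
  leadingAscents (true ∷ bs)  = suc (leadingAscents bs)
  leadingAscents (false ∷ bs) = 0

  laterRuns : List Bool → List ℕ
  laterRuns []           = []
  laterRuns (true ∷ bs)  = laterRuns bs
  laterRuns (false ∷ bs) = runsOf 1 bs

  runsOf-split : ∀ len bs → runsOf len bs ≡ (len + leadingAscents bs) ∷ laterRuns bs
  runsOf-split len []           = cong (_∷ []) (sym (+-identityʳ len))
  runsOf-split len (true ∷ bs)  =
    trans (runsOf-split (suc len) bs) (cong (_∷ laterRuns bs) (sym (+-suc len (leadingAscents bs))))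
  runsOf-split len (false ∷ bs) = cong (_∷ runsOf 1 bs) (sym (+-identityʳ len))

  -- The ascent pattern of a code: uᵢ uᵢ₊₁ is an ascent iff uᵢ ≤ uᵢ₊₁ (this is the ascent
  -- pattern of the encoded permutation, see ascents-fromCode).
  ascents : ∀ {n} → Code n → List Bool
  ascents nil             = []
  ascents (u ◂ nil)       = []
  ascents (u ◂ (u' ◂ c))  = (toℕ u ≤ᵇ toℕ u') ∷ ascents (u' ◂ c)

  -- Permutations as codes.  A word x xs of distinct letters is encoded by its first letter x
  -- followed by the code of xs with the gap at x squeezed out; decoding punches the gap back in.

  wordAscents : List ℕ → List Bool
  wordAscents []           = []
  wordAscents (x ∷ [])     = []
  wordAscents (x ∷ y ∷ ys) = (x <ᵇ y) ∷ wordAscents (y ∷ ys)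

  runsFrom-ascents : ∀ prev len ys → runsFrom prev len ys ≡ runsOf len (wordAscents (prev ∷ ys))
  runsFrom-ascents prev len []       = refl
  runsFrom-ascents prev len (y ∷ ys) with prev <ᵇ y
  ... | true  = runsFrom-ascents y (suc len) ys
  ... | false = cong (len ∷_) (runsFrom-ascents y 1 ys)

  values : ∀ {a k} → Vec (Fin a) k → List ℕ
  values v = List.map toℕ (toList v)

  punchIn-<ᵇ : ∀ {n} (x : Fin (suc n)) (a b : Fin n) → (toℕ (punchIn x a) <ᵇ toℕ (punchIn x b)) ≡ (toℕ a <ᵇ toℕ b)
  punchIn-<ᵇ fz     a      b      = refl
  punchIn-<ᵇ (fs x) fz     fz     = refl
  punchIn-<ᵇ (fs x) fz     (fs b) = refl
  punchIn-<ᵇ (fs x) (fs a) fz     = refl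
  punchIn-<ᵇ (fs x) (fs a) (fs b) = punchIn-<ᵇ x a b

  punchIn-≡ᵇ : ∀ {n} (x : Fin (suc n)) (a b : Fin n) → (toℕ (punchIn x a) ≡ᵇ toℕ (punchIn x b)) ≡ (toℕ a ≡ᵇ toℕ b)
  punchIn-≡ᵇ fz     a      b      = refl
  punchIn-≡ᵇ (fs x) fz     fz     = refl
  punchIn-≡ᵇ (fs x) fz     (fs b) = refl
  punchIn-≡ᵇ (fs x) (fs a) fz     = refl
  punchIn-≡ᵇ (fs x) (fs a) (fs b) = punchIn-≡ᵇ x a b

  -- x lies below punchIn x y exactly when x ≤ y: the ascent rule for codes.
  <ᵇ-punchIn : ∀ {n} (x : Fin (suc n)) (y : Fin n) → (toℕ x <ᵇ toℕ (punchIn x y)) ≡ (toℕ x ≤ᵇ toℕ y)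
  <ᵇ-punchIn fz     y      = refl
  <ᵇ-punchIn (fs x) fz     = refl
  <ᵇ-punchIn (fs x) (fs y) = trans (<ᵇ-punchIn x y) (sym (≤ᵇ-suc (toℕ x) (toℕ y)))

  ≡ᵇ-punchIn : ∀ {n} (x : Fin (suc n)) (y : Fin n) → (toℕ x ≡ᵇ toℕ (punchIn x y)) ≡ false
  ≡ᵇ-punchIn fz     y      = refl
  ≡ᵇ-punchIn (fs x) fz     = refl
  ≡ᵇ-punchIn (fs x) (fs y) = ≡ᵇ-punchIn x y

  -- squeeze x: a left inverse of punchIn x, defined everywhere (it sends x to a neighbour).
  squeeze : ∀ {n} → Fin (suc (suc n)) → Fin (suc (suc n)) → Fin (suc n)
  squeeze fz             fz     = fz
  squeeze fz             (fs y) = y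
  squeeze (fs x)         fz     = fz
  squeeze {zero}  (fs x) (fs y) = fz
  squeeze {suc n} (fs x) (fs y) = fs (squeeze x y)

  squeeze-punchIn : ∀ {n} (x : Fin (suc (suc n))) (y : Fin (suc n)) → squeeze x (punchIn x y) ≡ y
  squeeze-punchIn         fz     y      = refl
  squeeze-punchIn         (fs x) fz     = refl
  squeeze-punchIn {suc n} (fs x) (fs y) = cong fs (squeeze-punchIn x y)

  punchIn-squeeze : ∀ {n} (x y : Fin (suc (suc n))) → x ≢ y → punchIn x (squeeze x y) ≡ y
  punchIn-squeeze         fz          fz     x≢y = ⊥-elim (x≢y refl)
  punchIn-squeeze         fz          (fs y) _   = refl
  punchIn-squeeze         (fs x)      fz     _   = refl
  punchIn-squeeze {zero}  (fs fz)     (fs fz) x≢y = ⊥-elim (x≢y refl)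
  punchIn-squeeze {suc n} (fs x)      (fs y) x≢y = cong fs (punchIn-squeeze x y (x≢y ∘ cong fs))

  fromCode : ∀ {n} → Code n → Vec (Fin n) n
  fromCode nil     = []
  fromCode (u ◂ c) = u ∷ Vec.map (punchIn u) (fromCode c)

  removeFirst : ∀ {n} → Fin (suc n) → Vec (Fin (suc n)) n → Vec (Fin n) n
  removeFirst {zero}  x [] = []
  removeFirst {suc n} x xs = Vec.map (squeeze x) xs

  toCode : ∀ {n} → Vec (Fin n) n → Code n
  toCode {zero}  []       = nil
  toCode {suc n} (x ∷ xs) = x ◂ toCode (removeFirst x xs)

  wordAscents-punchIn : ∀ {n k} (x : Fin (suc n)) (w : Vec (Fin n) k) →
    wordAscents (values (Vec.map (punchIn x) w)) ≡ wordAscents (values w)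
  wordAscents-punchIn x []          = refl
  wordAscents-punchIn x (a ∷ [])    = refl
  wordAscents-punchIn x (a ∷ b ∷ w) = cong₂ _∷_ (punchIn-<ᵇ x a b) (wordAscents-punchIn x (b ∷ w))

  ascents-fromCode : ∀ {n} (c : Code n) → wordAscents (values (fromCode c)) ≡ ascents c
  ascents-fromCode nil              = refl
  ascents-fromCode (u ◂ nil)        = refl
  ascents-fromCode (u ◂ (u' ◂ c))   =
    cong₂ _∷_ (<ᵇ-punchIn u u')
              (trans (wordAscents-punchIn u (u' ∷ Vec.map (punchIn u') (fromCode c))) (ascents-fromCode (u' ◂ c)))

  avoids : ℕ → List ℕ → Bool
  avoids x = allB (λ y → not (x ≡ᵇ y))

  avoids-punchIn : ∀ {n k} (x : Fin (suc n)) (w : Vec (Fin n) k) → avoids (toℕ x) (values (Vec.map (punchIn x) w)) ≡ true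
  avoids-punchIn x []      = refl
  avoids-punchIn x (a ∷ w) rewrite ≡ᵇ-punchIn x a = avoids-punchIn x w

  avoids-map-punchIn : ∀ {n k} (x : Fin (suc n)) (a : Fin n) (w : Vec (Fin n) k) →
    avoids (toℕ (punchIn x a)) (values (Vec.map (punchIn x) w)) ≡ avoids (toℕ a) (values w)
  avoids-map-punchIn x a []      = refl
  avoids-map-punchIn x a (b ∷ w) rewrite punchIn-≡ᵇ x a b = cong (not (toℕ a ≡ᵇ toℕ b) ∧_) (avoids-map-punchIn x a w)

  distinct-punchIn : ∀ {n k} (x : Fin (suc n)) (w : Vec (Fin n) k) →
    distinct (values (Vec.map (punchIn x) w)) ≡ distinct (values w)
  distinct-punchIn x []      = refl
  distinct-punchIn x (a ∷ w) = cong₂ _∧_ (avoids-map-punchIn x a w) (distinct-punchIn x w)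

  isPerm-fromCode : ∀ {n} (c : Code n) → isPerm (fromCode c) ≡ true
  isPerm-fromCode nil     = refl
  isPerm-fromCode (u ◂ c) rewrite avoids-punchIn u (fromCode c) | distinct-punchIn u (fromCode c) = isPerm-fromCode c

  removeFirst-punchIn : ∀ {n} (x : Fin (suc n)) (w : Vec (Fin n) n) → removeFirst x (Vec.map (punchIn x) w) ≡ w
  removeFirst-punchIn {zero}  x [] = refl
  removeFirst-punchIn {suc n} x w  = trans (sym (map-∘ (squeeze x) (punchIn x) w)) (trans (map-cong (squeeze-punchIn x) w) (map-id w))

  toCode-fromCode : ∀ {n} (c : Code n) → toCode (fromCode c) ≡ c
  toCode-fromCode nil     = refl
  toCode-fromCode (u ◂ c) = cong (u ◂_) (trans (cong toCode (removeFirst-punchIn u (fromCode c))) (toCode-fromCode c))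

  punchIn-squeeze-avoiding : ∀ {n k} (x : Fin (suc (suc n))) (w : Vec (Fin (suc (suc n))) k) →
    T (avoids (toℕ x) (values w)) → Vec.map (punchIn x) (Vec.map (squeeze x) w) ≡ w
  punchIn-squeeze-avoiding x []      _ = refl
  punchIn-squeeze-avoiding x (a ∷ w) p =
    cong₂ _∷_ (punchIn-squeeze x a x≢a) (punchIn-squeeze-avoiding x w (proj₂ (Equivalence.to T-∧ p)))
    where
    x≢a : x ≢ a
    x≢a refl = subst T (Equivalence.to T-not-≡ (proj₁ (Equivalence.to T-∧ p))) (≡⇒≡ᵇ (toℕ x) (toℕ x) refl)

  punchIn-removeFirst : ∀ {n} (x : Fin (suc n)) (w : Vec (Fin (suc n)) n) →
    T (avoids (toℕ x) (values w)) → Vec.map (punchIn x) (removeFirst x w) ≡ w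
  punchIn-removeFirst {zero}  x [] _ = refl
  punchIn-removeFirst {suc n} x w  p = punchIn-squeeze-avoiding x w p

  fromCode-toCode : ∀ {n} (v : Vec (Fin n) n) → T (isPerm v) → fromCode (toCode v) ≡ v
  fromCode-toCode {zero}  []       _ = refl
  fromCode-toCode {suc n} (x ∷ xs) p = cong (x ∷_) (begin
    Vec.map (punchIn x) (fromCode (toCode (removeFirst x xs)))
      ≡⟨ cong (Vec.map (punchIn x)) (fromCode-toCode (removeFirst x xs) rest-distinct) ⟩
    Vec.map (punchIn x) (removeFirst x xs)
      ≡⟨ restored ⟩
    xs ∎)
    where
    open ≡-Reasoning
    x-avoided = proj₁ (Equivalence.to T-∧ p)
    restored : Vec.map (punchIn x) (removeFirst x xs) ≡ xs
    restored = punchIn-removeFirst x xs x-avoided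
    rest-distinct : T (isPerm (removeFirst x xs))
    rest-distinct = subst T (distinct-punchIn x (removeFirst x xs))
      (subst (λ z → T (distinct (values z))) (sym restored) (proj₂ (Equivalence.to (T-∧ {avoids (toℕ x) (values xs)}) p)))

  -- Everything about runs is generic in the set of admissible run lengths, as long as the
  -- empty remainder of a run (length 0) is admissible.
  module Runs (ok : ℕ → Bool) (ok0 : ok 0 ≡ true) where

    good : ∀ {n} → Code n → Bool
    good nil     = true
    good (u ◂ c) = allB ok (runsOf 1 (ascents (u ◂ c)))

    G : ℕ → ℕ
    G n = count n good

    -- rising i c: the first i letters of c are weakly increasing (form the beginning of a run)
    -- and the code left after removing them is good.
    rising : ∀ {n} → ℕ → Code n → Bool
    rising zero          c               = good c
    rising (suc i)       nil             = false
    rising (suc zero)    (u ◂ c)         = good c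
    rising (suc (suc i)) (u ◂ nil)       = false
    rising (suc (suc i)) (u ◂ (u' ◂ c))  = (toℕ u ≤ᵇ toℕ u') ∧ rising (suc i) (u' ◂ c)

    firstRun : ∀ {n} → Code n → ℕ
    firstRun c = suc (leadingAscents (ascents c))

    laterRunsOK : ∀ {n} → Code n → Bool
    laterRunsOK c = allB ok (laterRuns (ascents c))

    fits : ℕ → ℕ → Bool
    fits j i = (i ≤ᵇ j) ∧ ok (j ∸ i)

    fits-suc : ∀ j i → fits (suc j) (suc i) ≡ fits j i
    fits-suc j zero    = refl
    fits-suc j (suc i) = refl

    good-split : ∀ {n} (u : Fin (suc n)) (c : Code n) →
      good (u ◂ c) ≡ ok (firstRun (u ◂ c)) ∧ laterRunsOK (u ◂ c)
    good-split u c rewrite runsOf-split 1 (ascents (u ◂ c)) = refl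

    rising-split : ∀ {n} i (u : Fin (suc n)) (c : Code n) →
      rising i (u ◂ c) ≡ fits (firstRun (u ◂ c)) i ∧ laterRunsOK (u ◂ c)
    rising-split zero          u c        = good-split u c
    rising-split (suc zero)    u nil      = sym (cong (_∧ true) ok0)
    rising-split (suc (suc i)) u nil      = refl
    rising-split (suc zero)    u (u' ◂ c) with toℕ u ≤ᵇ toℕ u'
    ... | true  = good-split u' c
    ... | false = sym (cong (_∧ good (u' ◂ c)) ok0)
    rising-split (suc (suc i)) u (u' ◂ c) with toℕ u ≤ᵇ toℕ u'
    ... | true  = trans (rising-split (suc i) u' c)
                        (cong (_∧ laterRunsOK (u' ◂ c)) (sym (fits-suc (firstRun (u' ◂ c)) (suc i))))
    ... | false = refl

    -- Codes of rising l + 1 with a prescribed first letter u: the next l − 1 letters lie in [u, l + k].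
    count-rising-from : ∀ l k (u : Fin (suc (l + k))) →
      count (l + k) (λ c → rising (suc l) (u ◂ c)) ≡ ((l + k ∸ toℕ u) C l) * G k
    count-rising-from zero    k u = sym (*-identityˡ (G k))
    count-rising-from (suc l) k u = begin
      ∑[ u' < suc (l + k) ] count (l + k) (λ c → (toℕ u ≤ᵇ toℕ u') ∧ rising (suc l) (u' ◂ c))
        ≡⟨ sum-cong-≗ {suc (l + k)} (λ u' → restrict u') ⟩
      ∑[ u' < suc (l + k) ] ((⟦ toℕ u ≤ᵇ toℕ u' ⟧ * ((l + k ∸ toℕ u') C l)) * G k)
        ≡⟨ sym (*-distribʳ-sum {suc (l + k)} (G k) (λ u' → ⟦ toℕ u ≤ᵇ toℕ u' ⟧ * ((l + k ∸ toℕ u') C l))) ⟩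
      ∑[ u' < suc (l + k) ] (⟦ toℕ u ≤ᵇ toℕ u' ⟧ * ((l + k ∸ toℕ u') C l)) * G k
        ≡⟨ cong (_* G k) (hockey-stick-from (l + k) (toℕ u) l (s≤s⁻¹ (toℕ<n u))) ⟩
      ((suc (l + k) ∸ toℕ u) C suc l) * G k ∎
      where
      open ≡-Reasoning
      restrict : ∀ u' → count (l + k) (λ c → (toℕ u ≤ᵇ toℕ u') ∧ rising (suc l) (u' ◂ c))
                        ≡ (⟦ toℕ u ≤ᵇ toℕ u' ⟧ * ((l + k ∸ toℕ u') C l)) * G k
      restrict u' = begin
        count (l + k) (λ c → (toℕ u ≤ᵇ toℕ u') ∧ rising (suc l) (u' ◂ c))
          ≡⟨ ∑Code-cong (l + k) (λ c → ⟦∧⟧ (toℕ u ≤ᵇ toℕ u') (rising (suc l) (u' ◂ c))) ⟩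
        ∑Code (l + k) (λ c → ⟦ toℕ u ≤ᵇ toℕ u' ⟧ * ⟦ rising (suc l) (u' ◂ c) ⟧)
          ≡⟨ ∑Code-*ˡ (l + k) ⟦ toℕ u ≤ᵇ toℕ u' ⟧ (λ c → ⟦ rising (suc l) (u' ◂ c) ⟧) ⟩
        ⟦ toℕ u ≤ᵇ toℕ u' ⟧ * count (l + k) (λ c → rising (suc l) (u' ◂ c))
          ≡⟨ cong (⟦ toℕ u ≤ᵇ toℕ u' ⟧ *_) (count-rising-from l k u') ⟩
        ⟦ toℕ u ≤ᵇ toℕ u' ⟧ * (((l + k ∸ toℕ u') C l) * G k)
          ≡⟨ sym (*-assoc ⟦ toℕ u ≤ᵇ toℕ u' ⟧ ((l + k ∸ toℕ u') C l) (G k)) ⟩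
        (⟦ toℕ u ≤ᵇ toℕ u' ⟧ * ((l + k ∸ toℕ u') C l)) * G k ∎

    -- |rising i| = C(i + k, i) · G k on codes of length i + k: choose the first i values.
    count-rising : ∀ i k → count (i + k) (rising i) ≡ ((i + k) C i) * G k
    count-rising zero    k = sym (*-identityˡ (G k))
    count-rising (suc l) k = begin
      ∑[ u < suc (l + k) ] count (l + k) (λ c → rising (suc l) (u ◂ c))
        ≡⟨ sum-cong-≗ {suc (l + k)} (count-rising-from l k) ⟩
      ∑[ u < suc (l + k) ] (((l + k ∸ toℕ u) C l) * G k)
        ≡⟨ sym (*-distribʳ-sum {suc (l + k)} (G k) (λ u → (l + k ∸ toℕ u) C l)) ⟩
      ∑[ u < suc (l + k) ] ((l + k ∸ toℕ u) C l) * G k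
        ≡⟨ cong (_* G k) (hockey-stick (l + k) l) ⟩
      (suc (l + k) C suc l) * G k ∎
      where open ≡-Reasoning

    rising-too-long : ∀ {n} i (c : Code n) → n < i → rising i c ≡ false
    rising-too-long (suc i)       nil              _        = refl
    rising-too-long (suc zero)    (u ◂ c)          (s≤s ())
    rising-too-long (suc (suc i)) (u ◂ nil)        _        = refl
    rising-too-long (suc (suc i)) (u ◂ (u' ◂ c))   (s≤s lt) =
      trans (cong ((toℕ u ≤ᵇ toℕ u') ∧_) (rising-too-long (suc i) (u' ◂ c) lt)) (∧-zeroʳ (toℕ u ≤ᵇ toℕ u'))

    count-rising-too-long : ∀ n i → n < i → count n (rising i) ≡ 0
    count-rising-too-long n i lt = trans (∑Code-cong n (λ c → cong ⟦_⟧ (rising-too-long i c lt))) (∑Code-zero n)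

    module _ {K} (s : Fin K → ℕ) (unique : ∀ j → ∑[ k < K ] ⟦ fits j (s k) ⟧ ≡ 1) where

      rising-nil : ∀ i → rising i nil ≡ fits 0 i
      rising-nil zero    = sym ok0
      rising-nil (suc i) = refl

      ∑-rising : ∀ {n} (u : Fin (suc n)) (c : Code n) (t : Fin K → ℕ) j →
        (∀ k → fits (firstRun (u ◂ c)) (t k) ≡ fits j (s k)) →
        ∑[ k < K ] ⟦ rising (t k) (u ◂ c) ⟧ ≡ ⟦ laterRunsOK (u ◂ c) ⟧
      ∑-rising u c t j same = begin
        ∑[ k < K ] ⟦ rising (t k) (u ◂ c) ⟧
          ≡⟨ sum-cong-≗ {K} (λ k → trans (cong ⟦_⟧ (rising-split (t k) u c)) (⟦∧⟧ _ ρ)) ⟩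
        ∑[ k < K ] (⟦ fits (firstRun (u ◂ c)) (t k) ⟧ * ⟦ ρ ⟧)
          ≡⟨ sum-cong-≗ {K} (λ k → cong (λ b → ⟦ b ⟧ * ⟦ ρ ⟧) (same k)) ⟩
        ∑[ k < K ] (⟦ fits j (s k) ⟧ * ⟦ ρ ⟧)
          ≡⟨ sym (*-distribʳ-sum {K} ⟦ ρ ⟧ (λ k → ⟦ fits j (s k) ⟧)) ⟩
        ∑[ k < K ] ⟦ fits j (s k) ⟧ * ⟦ ρ ⟧
          ≡⟨ cong (_* ⟦ ρ ⟧) (unique j) ⟩
        1 * ⟦ ρ ⟧
          ≡⟨ *-identityˡ ⟦ ρ ⟧ ⟩
        ⟦ ρ ⟧ ∎
        where
        open ≡-Reasoning
        ρ = laterRunsOK (u ◂ c)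

      rising-identity-code : ∀ {n} (c : Code n) →
        ∑[ k < K ] ⟦ rising (s k) c ⟧ ≡ ⟦ n ≡ᵇ 0 ⟧ + ∑[ k < K ] ⟦ rising (suc (s k)) c ⟧
      rising-identity-code nil =
        trans (sum-cong-≗ {K} (λ k → cong ⟦_⟧ (rising-nil (s k))))
              (trans (unique 0) (cong suc (sym (sum-replicate-zero K))))
      rising-identity-code (u ◂ c) =
        trans (∑-rising u c s (firstRun (u ◂ c)) (λ _ → refl))
              (sym (∑-rising u c (suc ∘ s) (leadingAscents (ascents (u ◂ c))) (λ k → fits-suc _ (s k))))

      rising-identity : ∀ n →
        ∑[ k < K ] count n (rising (s k)) ≡ ⟦ n ≡ᵇ 0 ⟧ + ∑[ k < K ] count n (rising (suc (s k)))
      rising-identity n = begin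
        ∑[ k < K ] count n (rising (s k))
          ≡⟨ sym (∑Code-∑ n K (λ k c → ⟦ rising (s k) c ⟧)) ⟩
        ∑Code n (λ c → ∑[ k < K ] ⟦ rising (s k) c ⟧)
          ≡⟨ ∑Code-cong n rising-identity-code ⟩
        ∑Code n (λ c → ⟦ n ≡ᵇ 0 ⟧ + ∑[ k < K ] ⟦ rising (suc (s k)) c ⟧)
          ≡⟨ ∑Code-+ n (λ _ → ⟦ n ≡ᵇ 0 ⟧) (λ c → ∑[ k < K ] ⟦ rising (suc (s k)) c ⟧) ⟩
        ∑Code n (λ _ → ⟦ n ≡ᵇ 0 ⟧) + ∑Code n (λ c → ∑[ k < K ] ⟦ rising (suc (s k)) c ⟧)
          ≡⟨ cong₂ _+_ (∑Code-const n) (∑Code-∑ n K (λ k c → ⟦ rising (suc (s k)) c ⟧)) ⟩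
        ⟦ n ≡ᵇ 0 ⟧ + ∑[ k < K ] count n (rising (suc (s k))) ∎
        where
        open ≡-Reasoning
        ∑Code-const : ∀ n → ∑Code n (λ _ → ⟦ n ≡ᵇ 0 ⟧) ≡ ⟦ n ≡ᵇ 0 ⟧
        ∑Code-const zero    = refl
        ∑Code-const (suc n) = ∑Code-zero (suc n)

  module Admissible (m r : ℕ) .{{_ : NonZero m}} .{{_ : NonZero r}} where

    private instance
      mr≢0 : NonZero (m * r)
      mr≢0 = m*n≢0 m r

    ok : ℕ → Bool
    ok l = (l % (m * r)) <ᵇ r

    r≤mr : r ≤ m * r
    r≤mr = m≤n*m r m

    small-residue : ∀ t → t < r → t % (m * r) ≡ t
    small-residue t t<r = m<n⇒m%n≡m (<-≤-trans t<r r≤mr)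

    ok0 : ok 0 ≡ true
    ok0 = Equivalence.to T-≡ (subst (λ z → T (z <ᵇ r)) (sym (small-residue 0 (>-nonZero⁻¹ r))) (<⇒<ᵇ (>-nonZero⁻¹ r)))

    open Runs ok ok0 public

    offset : ℕ → ℕ
    offset j = (j % (m * r)) / r

    offset<m : ∀ j → offset j < m
    offset<m j = m<n*o⇒m/o<n (m%n<n j (m * r))

    fits-offset : ∀ j → T (fits j (offset j * r))
    fits-offset j = Equivalence.from T-∧ (≤⇒≤ᵇ qr≤j , subst (λ z → T (z <ᵇ r)) (sym residue) (<⇒<ᵇ (m%n<n y r)))
      where
      y = j % (m * r)
      s = y % r
      a = j / (m * r)
      qr≤j : offset j * r ≤ j
      qr≤j = ≤-trans (m/n*n≤m y r) (m%n≤m j (m * r))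
      rest : j ∸ offset j * r ≡ s + a * (m * r)
      rest = begin
        j ∸ offset j * r                               ≡⟨ cong (_∸ offset j * r) (m≡m%n+[m/n]*n j (m * r)) ⟩
        y + a * (m * r) ∸ offset j * r                 ≡⟨ cong (λ z → z + a * (m * r) ∸ offset j * r) (m≡m%n+[m/n]*n y r) ⟩
        s + offset j * r + a * (m * r) ∸ offset j * r  ≡⟨ cong (_∸ offset j * r) (xy∙z≈xz∙y s (offset j * r) (a * (m * r))) ⟩
        s + a * (m * r) + offset j * r ∸ offset j * r  ≡⟨ m+n∸n≡m (s + a * (m * r)) (offset j * r) ⟩
        s + a * (m * r) ∎
        where open ≡-Reasoning
      residue : (j ∸ offset j * r) % (m * r) ≡ s
      residue = trans (cong (_% (m * r)) rest) (trans ([m+kn]%n≡m%n s a (m * r)) (small-residue s (m%n<n y r)))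

    fits-unique : ∀ j k → k < m → T (fits j (k * r)) → k ≡ offset j
    fits-unique j k k<m p = sym (begin
      offset j                                 ≡⟨ cong (λ z → (z % (m * r)) / r) decomposition ⟩
      (t + k * r + b * (m * r)) % (m * r) / r  ≡⟨ cong (_/ r) ([m+kn]%n≡m%n (t + k * r) b (m * r)) ⟩
      (t + k * r) % (m * r) / r                ≡⟨ cong (_/ r) (m<n⇒m%n≡m t+kr<mr) ⟩
      (t + k * r) / r                          ≡⟨ +-distrib-/-∣ʳ t (n∣m*n k) ⟩
      t / r + k * r / r                        ≡⟨ cong₂ _+_ (m<n⇒m/n≡0 t<r) (m*n/n≡m k r) ⟩
      k ∎)
      where
      open ≡-Reasoning
      kr≤j : k * r ≤ j
      kr≤j = ≤ᵇ⇒≤ (k * r) j (proj₁ (Equivalence.to T-∧ p))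
      t = (j ∸ k * r) % (m * r)
      b = (j ∸ k * r) / (m * r)
      t<r : t < r
      t<r = <ᵇ⇒< t r (proj₂ (Equivalence.to (T-∧ {k * r ≤ᵇ j}) p))
      decomposition : j ≡ t + k * r + b * (m * r)
      decomposition = begin
        j                        ≡⟨ sym (m∸n+n≡m kr≤j) ⟩
        j ∸ k * r + k * r        ≡⟨ cong (_+ k * r) (m≡m%n+[m/n]*n (j ∸ k * r) (m * r)) ⟩
        t + b * (m * r) + k * r  ≡⟨ xy∙z≈xz∙y t (b * (m * r)) (k * r) ⟩
        t + k * r + b * (m * r)  ∎
      t+kr<mr : t + k * r < m * r
      t+kr<mr = <-≤-trans (+-monoˡ-< (k * r) t<r) (*-monoˡ-≤ r k<m)

    unique-offset : ∀ j → ∑[ k < m ] ⟦ fits j (toℕ k * r) ⟧ ≡ 1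
    unique-offset j =
      trans (sum-cong-≗ {m} (λ k → cong ⟦_⟧ (fits≡offset (toℕ k) (toℕ<n k)))) (∑-indicator m (offset j) (offset<m j))
      where
      fits≡offset : ∀ k → k < m → fits j (k * r) ≡ (k ≡ᵇ offset j)
      fits≡offset k k<m = ⇔→≡ {z = true} (mk⇔
        (λ p → Equivalence.to T-≡ (≡⇒≡ᵇ k (offset j) (fits-unique j k k<m (Equivalence.from T-≡ p))))
        (λ e → Equivalence.to T-≡ (subst (λ z → T (fits j (z * r)))
                                         (sym (≡ᵇ⇒≡ k (offset j) (Equivalence.from T-≡ e))) (fits-offset j))))

    admissible-identity : ∀ n →
      ∑[ k < m ] count n (rising (toℕ k * r)) ≡ ⟦ n ≡ᵇ 0 ⟧ + ∑[ k < m ] count n (rising (suc (toℕ k * r)))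
    admissible-identity = rising-identity {m} (λ k → toℕ k * r) unique-offset

    runsOK-fromCode : ∀ {n} (c : Code n) → runsOK m r (runLengths (word (fromCode c))) ≡ good c
    runsOK-fromCode nil     = refl
    runsOK-fromCode (u ◂ c) = cong (allB ok)
      (trans (runsFrom-ascents (toℕ u) 1 (values (Vec.map (punchIn u) (fromCode c))))
             (cong (runsOf 1) (ascents-fromCode (u ◂ c))))

    goodPerm-↔ : ∀ n → GoodPerm m r n ↔ Fin (G n)
    goodPerm-↔ n = ↔-trans (mk↔ₛ′ encode decode encode-decode decode-encode) (count-↔ n good)
      where
      runsOK-toCode : ∀ v → T (isPerm v) → runsOK m r (runLengths (word v)) ≡ good (toCode v)
      runsOK-toCode v perm =
        trans (cong (λ w → runsOK m r (runLengths (word w))) (sym (fromCode-toCode v perm))) (runsOK-fromCode (toCode v))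
      encode : GoodPerm m r n → Σ (Code n) (T ∘ good)
      encode (v , p) = let perm , runs = Equivalence.to T-∧ p in toCode v , subst T (runsOK-toCode v perm) runs
      decode : Σ (Code n) (T ∘ good) → GoodPerm m r n
      decode (c , q) =
        fromCode c , Equivalence.from T-∧ (Equivalence.from T-≡ (isPerm-fromCode c) , subst T (sym (runsOK-fromCode c)) q)
      encode-decode : ∀ y → encode (decode y) ≡ y
      encode-decode (c , _) = Σ-≡-T (toCode-fromCode c)
      decode-encode : ∀ y → decode (encode y) ≡ y
      decode-encode (v , p) = Σ-≡-T (fromCode-toCode v (proj₁ (Equivalence.to T-∧ p)))

-- Part II: power series (rational arithmetic).
module _ where
  open import Data.Nat as ℕ using (ℕ; zero; suc; _!; _∸_; _≤_; _<_; s≤s; _≡ᵇ_; NonZero)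
  import Data.Nat.Properties as ℕP
  open import Data.Nat.Properties using (_!≢0; _!*_!≢0)
  open import Data.Nat.Combinatorics using (_C_; nCk≡n!/k![n-k]!; k![n∸k]!∣n!)
  open import Data.Nat.DivMod using (m/n*n≡m)
  open import Data.Nat.Induction using (<-rec)
  open import Data.Integer as ℤ using (ℤ; +_)
  import Data.Integer.Properties as ℤP
  open import Data.Rational as ℚ using (ℚ; _/_; 0ℚ; 1ℚ; _+_; _*_; _-_; toℚᵘ)
  import Data.Rational.Properties as ℚP
  import Data.Rational.Unnormalised as ℚᵘ
  import Data.Rational.Unnormalised.Properties as ℚᵘP
  open import Data.Rational.Solver using (module +-*-Solver)
  open +-*-Solver using (solve; _:+_; _:*_; _:-_; _:=_)
  open import Algebra.Properties.Group ℚP.+-0-group using (∙-cancelʳ)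
  open import Defs using (sumℚ; monoFact; _⋆_; oneSeries; IsInverseOf; F)

  ι : ℕ → ℚ
  ι k = (+ k) / 1

  invFact : ℕ → ℚ
  invFact e = ((+ 1) / (e !)) {{e !≢0}}

  -- ι is a semiring homomorphism and ι k · (1/k) = 1; all three are checked on unnormalised
  -- rationals, where they are integer identities.
  toℚᵘ-/ : ∀ (a : ℤ) (d : ℕ) → toℚᵘ (a / suc d) ℚᵘ.≃ ℚᵘ.mkℚᵘ a d
  toℚᵘ-/ a d = ℚP.toℚᵘ-fromℚᵘ (ℚᵘ.mkℚᵘ a d)

  ι-+ : ∀ a b → ι (a ℕ.+ b) ≡ ι a + ι b
  ι-+ a b = ℚP.toℚᵘ-injective (begin
    toℚᵘ (ι (a ℕ.+ b))                     ≈⟨ toℚᵘ-/ (+ (a ℕ.+ b)) 0 ⟩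
    ℚᵘ.mkℚᵘ (+ (a ℕ.+ b)) 0                 ≈⟨ ℚᵘ.*≡* integral ⟨
    ℚᵘ.mkℚᵘ (+ a) 0 ℚᵘ.+ ℚᵘ.mkℚᵘ (+ b) 0    ≈⟨ ℚᵘP.+-cong (toℚᵘ-/ (+ a) 0) (toℚᵘ-/ (+ b) 0) ⟨
    toℚᵘ (ι a) ℚᵘ.+ toℚᵘ (ι b)              ≈⟨ ℚP.toℚᵘ-homo-+ (ι a) (ι b) ⟨
    toℚᵘ (ι a + ι b)                        ∎)
    where
    open ℚᵘP.≃-Reasoning
    integral = trans (ℤP.*-identityʳ _) (trans (cong₂ ℤ._+_ (ℤP.*-identityʳ (+ a)) (ℤP.*-identityʳ (+ b)))
                 (trans (sym (ℤP.pos-+ a b)) (sym (ℤP.*-identityʳ _))))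

  ι-* : ∀ a b → ι (a ℕ.* b) ≡ ι a * ι b
  ι-* a b = ℚP.toℚᵘ-injective (begin
    toℚᵘ (ι (a ℕ.* b))                     ≈⟨ toℚᵘ-/ (+ (a ℕ.* b)) 0 ⟩
    ℚᵘ.mkℚᵘ (+ (a ℕ.* b)) 0                 ≈⟨ ℚᵘ.*≡* (cong (ℤ._* (+ 1)) (sym (ℤP.pos-* a b))) ⟨
    ℚᵘ.mkℚᵘ (+ a) 0 ℚᵘ.* ℚᵘ.mkℚᵘ (+ b) 0    ≈⟨ ℚᵘP.*-cong (toℚᵘ-/ (+ a) 0) (toℚᵘ-/ (+ b) 0) ⟨
    toℚᵘ (ι a) ℚᵘ.* toℚᵘ (ι b)              ≈⟨ ℚP.toℚᵘ-homo-* (ι a) (ι b) ⟨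
    toℚᵘ (ι a * ι b)                        ∎)
    where open ℚᵘP.≃-Reasoning

  ι-*-inverse : ∀ k .{{_ : NonZero k}} → ι k * ((+ 1) / k) ≡ 1ℚ
  ι-*-inverse (suc d) = ℚP.toℚᵘ-injective (begin
    toℚᵘ (ι (suc d) * ((+ 1) / suc d))          ≈⟨ ℚP.toℚᵘ-homo-* (ι (suc d)) ((+ 1) / suc d) ⟩
    toℚᵘ (ι (suc d)) ℚᵘ.* toℚᵘ ((+ 1) / suc d)  ≈⟨ ℚᵘP.*-cong (toℚᵘ-/ (+ suc d) 0) (toℚᵘ-/ (+ 1) d) ⟩
    ℚᵘ.mkℚᵘ (+ suc d) 0 ℚᵘ.* ℚᵘ.mkℚᵘ (+ 1) d     ≈⟨ ℚᵘ.*≡* integral ⟩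
    toℚᵘ 1ℚ                                     ∎)
    where
    open ℚᵘP.≃-Reasoning
    integral = trans (ℤP.*-identityʳ (+ suc d ℤ.* + 1)) (trans (ℤP.*-identityʳ (+ suc d))
                 (trans (cong +_ (sym (ℕP.*-identityˡ (suc d)))) (sym (ℤP.*-identityˡ (+ (1 ℕ.* suc d))))))

  ι-invFact : ∀ e → ι (e !) * invFact e ≡ 1ℚ
  ι-invFact e = ι-*-inverse (e !) {{e !≢0}}

  sumℚ-cong< : ∀ n {f g : ℕ → ℚ} → (∀ k → k < n → f k ≡ g k) → sumℚ n f ≡ sumℚ n g
  sumℚ-cong< zero    eq = refl
  sumℚ-cong< (suc n) eq = cong₂ _+_ (sumℚ-cong< n (λ k lt → eq k (ℕP.m<n⇒m<1+n lt))) (eq n ℕP.≤-refl)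

  sumℚ-cong : ∀ n {f g : ℕ → ℚ} → (∀ k → f k ≡ g k) → sumℚ n f ≡ sumℚ n g
  sumℚ-cong n eq = sumℚ-cong< n (λ k _ → eq k)

  sumℚ-*ʳ : ∀ n (f : ℕ → ℚ) y → sumℚ n f * y ≡ sumℚ n (λ i → f i * y)
  sumℚ-*ʳ zero    f y = ℚP.*-zeroˡ y
  sumℚ-*ʳ (suc n) f y = trans (ℚP.*-distribʳ-+ y (sumℚ n f) (f n)) (cong (_+ f n * y) (sumℚ-*ʳ n f y))

  sumℚ-+ : ∀ n (f g : ℕ → ℚ) → sumℚ n (λ i → f i + g i) ≡ sumℚ n f + sumℚ n g
  sumℚ-+ zero    f g = sym (ℚP.+-identityʳ 0ℚ)
  sumℚ-+ (suc n) f g = trans (cong (_+ (f n + g n)) (sumℚ-+ n f g))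
    (solve 4 (λ a b c d → (a :+ b) :+ (c :+ d) := (a :+ c) :+ (b :+ d)) refl (sumℚ n f) (sumℚ n g) (f n) (g n))

  sumℚ-− : ∀ n (f g : ℕ → ℚ) → sumℚ n (λ i → f i - g i) ≡ sumℚ n f - sumℚ n g
  sumℚ-− zero    f g = refl
  sumℚ-− (suc n) f g = trans (cong (_+ (f n - g n)) (sumℚ-− n f g))
    (solve 4 (λ a b c d → (a :- b) :+ (c :- d) := (a :+ c) :- (b :+ d)) refl (sumℚ n f) (sumℚ n g) (f n) (g n))

  sumℚ-zero : ∀ n → sumℚ n (λ _ → 0ℚ) ≡ 0ℚ
  sumℚ-zero zero    = refl
  sumℚ-zero (suc n) = trans (ℚP.+-identityʳ _) (sumℚ-zero n)

  sumℚ-swap : ∀ a b (h : ℕ → ℕ → ℚ) → sumℚ a (λ i → sumℚ b (h i)) ≡ sumℚ b (λ k → sumℚ a (λ i → h i k))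
  sumℚ-swap zero    b h = sym (sumℚ-zero b)
  sumℚ-swap (suc a) b h =
    trans (cong (_+ sumℚ b (h a)) (sumℚ-swap a b h)) (sym (sumℚ-+ b (λ k → sumℚ a (λ i → h i k)) (h a)))

  sumℚ-first : ∀ n (f : ℕ → ℚ) → sumℚ (suc n) f ≡ f 0 + sumℚ n (f ∘ suc)
  sumℚ-first zero    f = trans (ℚP.+-identityˡ (f 0)) (sym (ℚP.+-identityʳ (f 0)))
  sumℚ-first (suc n) f = trans (cong (_+ f (suc n)) (sumℚ-first n f)) (ℚP.+-assoc (f 0) _ _)

  sumℚ-ι : ∀ n (f : ℕ → ℕ) → sumℚ n (λ k → ι (f k)) ≡ ι (∑[ k < n ] f (toℕ k))
  sumℚ-ι zero    f = refl
  sumℚ-ι (suc n) f = begin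
    sumℚ (suc n) (λ k → ι (f k))               ≡⟨ sumℚ-first n (λ k → ι (f k)) ⟩
    ι (f 0) + sumℚ n (λ k → ι (f (suc k)))      ≡⟨ cong (ι (f 0) ℚ.+_) (sumℚ-ι n (f ∘ suc)) ⟩
    ι (f 0) + ι (∑[ k < n ] f (suc (toℕ k)))    ≡⟨ sym (ι-+ (f 0) _) ⟩
    ι (∑[ k < suc n ] f (toℕ k)) ∎
    where open ≡-Reasoning

  ⋆-sum-of-differences : ∀ m (a b : ℕ → ℕ → ℚ) (y : ℕ → ℚ) n →
    ((λ j → sumℚ m (λ k → a k j - b k j)) ⋆ y) n ≡ sumℚ m (λ k → (a k ⋆ y) n) - sumℚ m (λ k → (b k ⋆ y) n)
  ⋆-sum-of-differences m a b y n = begin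
    sumℚ (suc n) (λ i → sumℚ m (λ k → a k i - b k i) * y (n ∸ i))
      ≡⟨ sumℚ-cong (suc n) (λ i → trans (sumℚ-*ʳ m (λ k → a k i - b k i) (y (n ∸ i)))
                                        (sumℚ-cong m (λ k → distrib (a k i) (b k i) (y (n ∸ i))))) ⟩
    sumℚ (suc n) (λ i → sumℚ m (λ k → a k i * y (n ∸ i) - b k i * y (n ∸ i)))
      ≡⟨ sumℚ-swap (suc n) m (λ i k → a k i * y (n ∸ i) - b k i * y (n ∸ i)) ⟩
    sumℚ m (λ k → sumℚ (suc n) (λ i → a k i * y (n ∸ i) - b k i * y (n ∸ i)))
      ≡⟨ sumℚ-cong m (λ k → sumℚ-− (suc n) (λ i → a k i * y (n ∸ i)) (λ i → b k i * y (n ∸ i))) ⟩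
    sumℚ m (λ k → (a k ⋆ y) n - (b k ⋆ y) n)
      ≡⟨ sumℚ-− m (λ k → (a k ⋆ y) n) (λ k → (b k ⋆ y) n) ⟩
    sumℚ m (λ k → (a k ⋆ y) n) - sumℚ m (λ k → (b k ⋆ y) n) ∎
    where
    open ≡-Reasoning
    distrib : ∀ p q z → (p - q) * z ≡ p * z - q * z
    distrib = solve 3 (λ p q z → (p :- q) :* z := p :* z :- q :* z) refl

  monoFact-off : ∀ e N → N ≢ e → monoFact e N ≡ 0ℚ
  monoFact-off e N N≢e with N ≡ᵇ e in eq
  ... | true  = ⊥-elim (N≢e (ℕP.≡ᵇ⇒≡ N e (Equivalence.from T-≡ eq)))
  ... | false = refl

  monoFact-on : ∀ e → monoFact e e ≡ invFact e
  monoFact-on e rewrite Equivalence.to T-≡ (ℕP.≡⇒≡ᵇ e e refl) = refl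

  sift-below : ∀ N e (y : ℕ → ℚ) → N ≤ e → sumℚ N (λ i → monoFact e i * y i) ≡ 0ℚ
  sift-below zero    e y _    = refl
  sift-below (suc N) e y N<e = begin
    sumℚ N (λ i → monoFact e i * y i) + monoFact e N * y N
      ≡⟨ cong₂ _+_ (sift-below N e y (ℕP.<⇒≤ N<e)) (cong (_* y N) (monoFact-off e N (ℕP.<⇒≢ N<e))) ⟩
    0ℚ + 0ℚ * y N
      ≡⟨ cong (0ℚ ℚ.+_) (ℚP.*-zeroˡ (y N)) ⟩
    0ℚ ∎
    where open ≡-Reasoning

  sift : ∀ N e (y : ℕ → ℚ) → e < N → sumℚ N (λ i → monoFact e i * y i) ≡ invFact e * y e
  sift (suc N) e y e<1+N with ℕP.m≤n⇒m<n∨m≡n (ℕ.s≤s⁻¹ e<1+N)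
  ... | inj₁ e<N = trans (cong₂ _+_ (sift N e y e<N) (cong (_* y N) (monoFact-off e N (ℕP.>⇒≢ e<N))))
                         (trans (cong (invFact e * y e ℚ.+_) (ℚP.*-zeroˡ (y N))) (ℚP.+-identityʳ _))
  ... | inj₂ refl = trans (cong₂ _+_ (sift-below N N y ℕP.≤-refl) (cong (_* y N) (monoFact-on N))) (ℚP.+-identityˡ _)

  binomial-factorials : ∀ e k → ((e ℕ.+ k) C e) ℕ.* (e ! ℕ.* k !) ≡ (e ℕ.+ k) !
  binomial-factorials e k = begin
    ((e ℕ.+ k) C e) ℕ.* (e ! ℕ.* k !)
      ≡⟨ cong (λ z → ((e ℕ.+ k) C e) ℕ.* (e ! ℕ.* z !)) (sym (ℕP.m+n∸m≡n e k)) ⟩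
    ((e ℕ.+ k) C e) ℕ.* (e ! ℕ.* (e ℕ.+ k ∸ e) !)
      ≡⟨ cong (ℕ._* (e ! ℕ.* (e ℕ.+ k ∸ e) !)) (nCk≡n!/k![n-k]! e≤e+k) ⟩
    ((e ℕ.+ k) ! ℕ./ (e ! ℕ.* (e ℕ.+ k ∸ e) !)) ℕ.* (e ! ℕ.* (e ℕ.+ k ∸ e) !)
      ≡⟨ m/n*n≡m (k![n∸k]!∣n! e≤e+k) ⟩
    (e ℕ.+ k) ! ∎
    where
    open ≡-Reasoning
    e≤e+k = ℕP.m≤m+n e k
    instance _ = e !* (e ℕ.+ k ∸ e) !≢0

  invFact-* : ∀ e k → invFact e * invFact k ≡ ι ((e ℕ.+ k) C e) * invFact (e ℕ.+ k)
  invFact-* e k = begin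
    invFact e * invFact k
      ≡⟨ sym (trans (cong ((invFact e * invFact k) *_) (ι-invFact (e ℕ.+ k))) (ℚP.*-identityʳ _)) ⟩
    (invFact e * invFact k) * (ι ((e ℕ.+ k) !) * invFact (e ℕ.+ k))
      ≡⟨ cong (λ w → (invFact e * invFact k) * (w * invFact (e ℕ.+ k))) (sym factorials) ⟩
    (invFact e * invFact k) * ((B * (ι (e !) * ι (k !))) * invFact (e ℕ.+ k))
      ≡⟨ solve 6 (λ ie ik iek B x y → (ie :* ik) :* ((B :* (x :* y)) :* iek) := (B :* iek) :* ((x :* ie) :* (y :* ik)))
               refl (invFact e) (invFact k) (invFact (e ℕ.+ k)) B (ι (e !)) (ι (k !)) ⟩
    (B * invFact (e ℕ.+ k)) * ((ι (e !) * invFact e) * (ι (k !) * invFact k))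
      ≡⟨ cong₂ (λ u v → (B * invFact (e ℕ.+ k)) * (u * v)) (ι-invFact e) (ι-invFact k) ⟩
    (B * invFact (e ℕ.+ k)) * (1ℚ * 1ℚ)
      ≡⟨ ℚP.*-identityʳ _ ⟩
    B * invFact (e ℕ.+ k) ∎
    where
    open ≡-Reasoning
    B = ι ((e ℕ.+ k) C e)
    factorials : B * (ι (e !) * ι (k !)) ≡ ι ((e ℕ.+ k) !)
    factorials = trans (cong (B *_) (sym (ι-* (e !) (k !))))
                       (trans (sym (ι-* ((e ℕ.+ k) C e) (e ! ℕ.* k !))) (cong ι (binomial-factorials e k)))

  -- A power series with constant term 1 has at most one inverse: the n-th equation of
  -- a ⋆ b = 1 determines b n from the earlier coefficients.
  ⋆-split : ∀ (a y : ℕ → ℚ) n → a 0 ≡ 1ℚ → (a ⋆ y) n ≡ y n + sumℚ n (λ i → a (suc i) * y (n ∸ suc i))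
  ⋆-split a y n a0 = trans (sumℚ-first n (λ i → a i * y (n ∸ i)))
    (cong (ℚ._+ sumℚ n (λ i → a (suc i) * y (n ∸ suc i))) (trans (cong (_* y n) a0) (ℚP.*-identityˡ (y n))))

  inverse-unique : ∀ (a b c : ℕ → ℚ) → a 0 ≡ 1ℚ → IsInverseOf b a → IsInverseOf c a → ∀ n → b n ≡ c n
  inverse-unique a b c a0 b-inv c-inv = <-rec (λ n → b n ≡ c n) step
    where
    later : (ℕ → ℚ) → ℕ → ℚ
    later y n = sumℚ n (λ i → a (suc i) * y (n ∸ suc i))
    step : ∀ n → (∀ {j} → j < n → b j ≡ c j) → b n ≡ c n
    step n earlier = ∙-cancelʳ (later c n) (b n) (c n) (begin
      b n + later c n  ≡⟨ cong (b n ℚ.+_) (sumℚ-cong< n (λ i i<n → cong (a (suc i) *_) (sym (earlier (before i<n))))) ⟩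
      b n + later b n  ≡⟨ sym (⋆-split a b n a0) ⟩
      (a ⋆ b) n        ≡⟨ trans (b-inv n) (sym (c-inv n)) ⟩
      (a ⋆ c) n        ≡⟨ ⋆-split a c n a0 ⟩
      c n + later c n  ∎)
      where
      open ≡-Reasoning
      before : ∀ {i} → i < n → n ∸ suc i < n
      before {i} (s≤s _) = s≤s (ℕP.m∸n≤m _ i)

  module Series (m r : ℕ) .{{_ : NonZero m}} .{{_ : NonZero r}} where
    open Admissible m r

    egf : ℕ → ℚ
    egf n = ι (G n) * invFact n

    monoFact-⋆-egf : ∀ n e → (monoFact e ⋆ egf) n ≡ ι (count n (rising e)) * invFact n
    monoFact-⋆-egf n e with e ℕP.≤? n
    ... | no  e≰n = trans (sift-below (suc n) e (λ i → egf (n ∸ i)) (ℕP.≰⇒> e≰n))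
      (sym (trans (cong (λ z → ι z * invFact n) (count-rising-too-long n e (ℕP.≰⇒> e≰n))) (ℚP.*-zeroˡ (invFact n))))
    ... | yes e≤n = subst (λ n → (monoFact e ⋆ egf) n ≡ ι (count n (rising e)) * invFact n)
                          (ℕP.m+[n∸m]≡n e≤n) (split-length (n ∸ e))
      where
      split-length : ∀ k → (monoFact e ⋆ egf) (e ℕ.+ k) ≡ ι (count (e ℕ.+ k) (rising e)) * invFact (e ℕ.+ k)
      split-length k = begin
        sumℚ (suc (e ℕ.+ k)) (λ i → monoFact e i * egf (e ℕ.+ k ∸ i))
          ≡⟨ sift (suc (e ℕ.+ k)) e (λ i → egf (e ℕ.+ k ∸ i)) (s≤s (ℕP.m≤m+n e k)) ⟩
        invFact e * egf (e ℕ.+ k ∸ e)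
          ≡⟨ cong (λ z → invFact e * egf z) (ℕP.m+n∸m≡n e k) ⟩
        invFact e * (ι (G k) * invFact k)
          ≡⟨ solve 3 (λ ie g ik → ie :* (g :* ik) := g :* (ie :* ik)) refl (invFact e) (ι (G k)) (invFact k) ⟩
        ι (G k) * (invFact e * invFact k)
          ≡⟨ cong (ι (G k) *_) (invFact-* e k) ⟩
        ι (G k) * (ι ((e ℕ.+ k) C e) * invFact (e ℕ.+ k))
          ≡⟨ solve 3 (λ g B i → g :* (B :* i) := (B :* g) :* i) refl (ι (G k)) (ι ((e ℕ.+ k) C e)) (invFact (e ℕ.+ k)) ⟩
        (ι ((e ℕ.+ k) C e) * ι (G k)) * invFact (e ℕ.+ k)
          ≡⟨ cong (_* invFact (e ℕ.+ k)) (sym (trans (cong ι (count-rising e k)) (ι-* ((e ℕ.+ k) C e) (G k)))) ⟩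
        ι (count (e ℕ.+ k) (rising e)) * invFact (e ℕ.+ k) ∎
        where open ≡-Reasoning

    F-zero : F m r 0 ≡ 1ℚ
    F-zero = trans (sumℚ-cong m term)
                   (trans (sumℚ-ι m (λ k → ⟦ k ≡ᵇ 0 ⟧)) (cong ι (∑-indicator m 0 (ℕ.>-nonZero⁻¹ m))))
      where
      term : ∀ k → monoFact (k ℕ.* r) 0 - monoFact (suc (k ℕ.* r)) 0 ≡ ι ⟦ k ≡ᵇ 0 ⟧
      term zero    = ℚP.+-identityʳ _
      term (suc k) = trans (ℚP.+-identityʳ _)
        (monoFact-off (suc k ℕ.* r) 0 (λ eq → ℕ.≢-nonZero⁻¹ (suc k ℕ.* r) {{ℕP.m*n≢0 (suc k) r}} (sym eq)))

    -- The main computation: F ⋆ egf = 1 is the identity of Admissible divided by n!.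
    egf-inverse : IsInverseOf egf (F m r)
    egf-inverse n = begin
      (F m r ⋆ egf) n
        ≡⟨ ⋆-sum-of-differences m (λ k → monoFact (k ℕ.* r)) (λ k → monoFact (suc (k ℕ.* r))) egf n ⟩
      sumℚ m (λ k → (monoFact (k ℕ.* r) ⋆ egf) n) - sumℚ m (λ k → (monoFact (suc (k ℕ.* r)) ⋆ egf) n)
        ≡⟨ cong₂ _-_ (counted (λ k → k ℕ.* r)) (counted (λ k → suc (k ℕ.* r))) ⟩
      ι (∑[ k < m ] count n (rising (toℕ k ℕ.* r))) * invFact n - ι S * invFact n
        ≡⟨ cong (λ z → ι z * invFact n - ι S * invFact n) (admissible-identity n) ⟩
      ι (⟦ n ≡ᵇ 0 ⟧ ℕ.+ S) * invFact n - ι S * invFact n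
        ≡⟨ cong (λ z → z * invFact n - ι S * invFact n) (ι-+ ⟦ n ≡ᵇ 0 ⟧ S) ⟩
      (ι ⟦ n ≡ᵇ 0 ⟧ + ι S) * invFact n - ι S * invFact n
        ≡⟨ solve 3 (λ a s i → (a :+ s) :* i :- s :* i := a :* i) refl (ι ⟦ n ≡ᵇ 0 ⟧) (ι S) (invFact n) ⟩
      ι ⟦ n ≡ᵇ 0 ⟧ * invFact n
        ≡⟨ unit n ⟩
      oneSeries n ∎
      where
      open ≡-Reasoning
      S = ∑[ k < m ] count n (rising (suc (toℕ k ℕ.* r)))
      counted : ∀ (s : ℕ → ℕ) →
        sumℚ m (λ k → (monoFact (s k) ⋆ egf) n) ≡ ι (∑[ k < m ] count n (rising (s (toℕ k)))) * invFact n
      counted s = trans (sumℚ-cong m (λ k → monoFact-⋆-egf n (s k)))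
        (trans (sym (sumℚ-*ʳ m (λ k → ι (count n (rising (s k)))) (invFact n)))
               (cong (_* invFact n) (sumℚ-ι m (λ k → count n (rising (s k))))))
      unit : ∀ n → ι ⟦ n ≡ᵇ 0 ⟧ * invFact n ≡ oneSeries n
      unit zero    = ι-invFact 0
      unit (suc n) = ℚP.*-zeroˡ (invFact (suc n))

    inverse-coefficient : ∀ b → IsInverseOf b (F m r) → ∀ n → b n * ι (n !) ≡ ι (G n)
    inverse-coefficient b b-inv n = begin
      b n * ι (n !)                    ≡⟨ cong (_* ι (n !)) (inverse-unique (F m r) b egf F-zero b-inv egf-inverse n) ⟩
      (ι (G n) * invFact n) * ι (n !)  ≡⟨ ℚP.*-assoc (ι (G n)) (invFact n) (ι (n !)) ⟩
      ι (G n) * (invFact n * ι (n !))  ≡⟨ cong (ι (G n) *_) (trans (ℚP.*-comm (invFact n) (ι (n !))) (ι-invFact n)) ⟩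
      ι (G n) * 1ℚ                     ≡⟨ ℚP.*-identityʳ (ι (G n)) ⟩
      ι (G n) ∎
      where open ≡-Reasoning

open import Defs using (IsInverseOf; F; GoodPerm)
open import Data.Nat using (ℕ; NonZero; _!)
open import Data.Rational using (ℚ; _*_; _/_)
open import Data.Integer using (+_)
open import Data.Product using (_×_)

proposition1 : (m r : ℕ) → .{{_ : NonZero m}} → .{{_ : NonZero r}} →
    Σ (ℕ → ℚ) (λ b → IsInverseOf b (F m r))
    × ((b : ℕ → ℚ) → IsInverseOf b (F m r) → (n : ℕ) →
    Σ ℕ (λ N → (b n * ((+ (n !)) / 1) ≡ (+ N) / 1) × (GoodPerm m r n ↔ Fin N)))
proposition1 m r =
  (egf , egf-inverse) ,
  λ b b-inv n → G n , inverse-coefficient b b-inv n , goodPerm-↔ n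
  where
  open Series m r
  open Admissible m r using (G; goodPerm-↔)
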